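{- Let $n\ge2$ and let $K$ be a pure $n$-simplicial complex. If $K$ contains an $(n-1,n)$-simplicial cycle sequence, then $K$ contains an $(m,n)$-simplicial cycle sequence for each $0\le m\le n-2$.
   Context: A simplicial complex on a finite vertex set is a collection of non-empty vertex subsets containing all singletons and closed under non-empty subsets; a $k$-simplex has $k+1$ vertices; $\tau$ is a face of $\sigma$ if $\tau\subseteq\sigma$. $K$ is a pure $n$-simplicial complex if $\dim K=n$ and every simplex is a face of some $n$-simplex. Let $0\le m\le n-1$. An $(m,n)$-walk sequence is an alternating sequence $\sigma_1,\eta_1,\sigma_2,\dots,\sigma_r,\eta_r,\sigma_{r+1}$ of $m$-simplices $\sigma_k$ and $n$-simplices $\eta_k$ with $\sigma_k\ne\sigma_{k+1}$ both faces of $\eta_k$. An $(m,n)$-simplicial cycle sequence is an $(m,n)$-walk sequence with $\sigma_{r+1}=\sigma_1$ and $\sigma_p\ne\sigma_q$, $\eta_p\ne\eta_q$ for $1\le p\ne q\le r$, such that (i) $r\ge 3$; (ii) $\sigma_1$ is not a face of $\eta_k$ for $2\le k\le r-1$; (iii) for each $2\le z\le r$ there is an $(n-1)$-simplex $\sigma'_z$ of $K$ which is a face of both $\eta_{z-1}$ and $\eta_z$ and has $\sigma_z$ as a face, with $\sigma'_x\ne\sigma'_y$ for $2\le x\ne y\le r$. -}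

module Defs where

open import Data.Nat using (ℕ; zero; suc; _+_; _∸_; _≤_; _<_)
open import Data.Fin using (Fin)
open import Data.Fin.Subset using (Subset; _⊆_; ∣_∣; ⁅_⁆; Nonempty)
open import Data.Product using (Σ; Σ-syntax; ∃; ∃-syntax; _×_)
open import Relation.Binary.PropositionalEquality using (_≡_; _≢_)
open import Relation.Nullary using (¬_)

record SimplicialComplex (V : ℕ) : Set₁ where
  field
    _∈K          : Subset V → Set
    nonempty     : ∀ σ → σ ∈K → Nonempty σ
    singletons   : ∀ v → ⁅ v ⁆ ∈K
    down-closed  : ∀ σ τ → σ ∈K → Nonempty τ → τ ⊆ σ → τ ∈K

open SimplicialComplex public

IsSimplex : ∀ {V} → SimplicialComplex V → ℕ → Subset V → Set
IsSimplex K k σ = (_∈K K σ) × (∣ σ ∣ ≡ suc k)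

HasDim : ∀ {V} → SimplicialComplex V → ℕ → Set
HasDim K n = (∃[ σ ] IsSimplex K n σ) × (∀ σ → _∈K K σ → ∣ σ ∣ ≤ suc n)

IsPure : ∀ {V} → SimplicialComplex V → ℕ → Set
IsPure K n = HasDim K n × (∀ σ → _∈K K σ → ∃[ η ] (IsSimplex K n η × σ ⊆ η))

-- An (m,n)-walk sequence σ₁,η₁,…,σ_r,η_r,σ_{r+1}, 1-indexed as in the paper
-- (values of σ, η at other indices are irrelevant).
IsWalk : ∀ {V} → SimplicialComplex V → ℕ → ℕ → (r : ℕ) →
         (ℕ → Subset V) → (ℕ → Subset V) → Set
IsWalk K m n r σ η =
  (∀ k → 1 ≤ k → k ≤ suc r → IsSimplex K m (σ k)) ×
  (∀ k → 1 ≤ k → k ≤ r →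
     IsSimplex K n (η k) × σ k ≢ σ (suc k) × σ k ⊆ η k × σ (suc k) ⊆ η k)

IsCycleSeq : ∀ {V} → SimplicialComplex V → ℕ → ℕ → (r : ℕ) →
             (ℕ → Subset V) → (ℕ → Subset V) → Set
IsCycleSeq {V} K m n r σ η =
  IsWalk K m n r σ η ×
  σ (suc r) ≡ σ 1 ×
  (∀ p q → 1 ≤ p → p ≤ r → 1 ≤ q → q ≤ r → p ≢ q → σ p ≢ σ q × η p ≢ η q) ×
  3 ≤ r ×
  (∀ k → 2 ≤ k → k ≤ r ∸ 1 → ¬ (σ 1 ⊆ η k)) ×
  (Σ[ σ′ ∈ (ℕ → Subset V) ]
     ((∀ z → 2 ≤ z → z ≤ r →
        IsSimplex K (n ∸ 1) (σ′ z) × σ′ z ⊆ η (z ∸ 1) × σ′ z ⊆ η z × σ z ⊆ σ′ z) ×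
      (∀ x y → 2 ≤ x → x ≤ r → 2 ≤ y → y ≤ r → x ≢ y → σ′ x ≢ σ′ y)))

HasCycleSeq : ∀ {V} → SimplicialComplex V → ℕ → ℕ → Set
HasCycleSeq {V} K m n =
  Σ[ r ∈ ℕ ] Σ[ σ ∈ (ℕ → Subset V) ] Σ[ η ∈ (ℕ → Subset V) ] IsCycleSeq K m n r σ η

{-# OPTIONS --safe #-}
-- A detour is a chain of facets η₁,…,η_ℓ (ℓ ≥ 3) glued along pairwise distinct ridges,
-- with pairwise distinct facets, together with an m-simplex ρ lying in η₁ and η_ℓ but
-- in no facet in between. The given (n-1,n)-cycle yields one: an m-face of σ₁ through
-- a vertex outside η_{r-1} lies in η₁ and η_r but not in η_{r-1}; take the last facet
-- before η_r containing it. Along a detour choose m-faces σ_k of the ridges with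
-- σ_k ⊈ η_{k-2}; this is possible because two consecutive ridges span a facet and the
-- facets are distinct. If the σ_k are pairwise distinct, ρ,η₁,σ₂,…,σ_ℓ,η_ℓ,ρ is an
-- (m,n)-cycle sequence. Otherwise a repetition σ_z = σ_w with z < w gives a strictly
-- shorter detour for σ_w between η_{z-1} and η_{w-1}, and we conclude by induction on ℓ.
module Submission where

open import Defs

open import Data.Bool using () renaming (_≟_ to _≟ᴮ_)
open import Data.Fin.Properties using (any?)
open import Data.Fin.Subset
  using (Subset; _∈_; _∉_; _⊆_; _⊈_; _∪_; ∣_∣; ⁅_⁆; Nonempty; inside; outside)
  renaming (⊥ to ∅)
open import Data.Fin.Subset.Properties
  using (_∈?_; _⊆?_; ⊆-trans; ⊆-antisym; ⊥⊆; out⊆; s⊆s; p⊂q⇒∣p∣<∣q∣; p⊆p∪q; q⊆p∪q;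
         x∈p∪q⁻; x∈⁅x⁆; x∈⁅y⁆⇒x≡y; ∣⁅x⁆∣≡1; ∣⊥∣≡0; nonempty?; Empty-unique)
open import Data.Nat using (ℕ; zero; suc; _+_; _∸_; _≤_; _<_; _≤?_; z≤n; s≤s)
open import Data.Nat.Induction using (<-rec)
open import Data.Nat.Properties
  using (≤-refl; ≤-reflexive; ≤-trans; ≤-antisym; ≤-pred; n≤1+n; m≤m+n; n<1+n; n≮n;
         <⇒≤; <⇒≢; <⇒≱; >⇒≢; ≰⇒>; m≤n⇒m<n∨m≡n; m<n⇒m<1+n; <-cmp; +-monoˡ-≤; +-monoˡ-<;
         +-cancelʳ-≡; +-cancelʳ-≤; m∸n≤m; m∸n+n≡m; anyUpTo?)
open import Data.Product using (∃; ∃-syntax; _×_; _,_; proj₁; proj₂)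
open import Data.Sum using (_⊎_; inj₁; inj₂; [_,_])
open import Data.Vec using (_∷_; here; there)
open import Data.Vec.Properties using (≡-dec)
open import Function using (id; _∘_)
open import Relation.Binary.PropositionalEquality using (_≡_; _≢_; refl; sym; trans; cong; subst)
open import Relation.Nullary using (¬_; Dec; yes; no; ¬?; contradiction)
open import Relation.Nullary.Decidable using (_×-dec_; decidable-stable)
open import Relation.Unary using (Pred; Decidable)
open import Relation.Binary.Definitions using (tri<; tri≈; tri>)

module _ {V : ℕ} where

  ⊈⇒∃∉ : {p q : Subset V} → p ⊈ q → ∃[ x ] x ∈ p × x ∉ q
  ⊈⇒∃∉ {p} {q} p⊈q with any? (λ x → x ∈? p ×-dec ¬? (x ∈? q))
  ... | yes witness = witness
  ... | no none = contradiction
    (λ {x} x∈p → decidable-stable (x ∈? q) (λ x∉q → none (x , x∈p , x∉q))) p⊈q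

  p⊆q∧∣q∣≤∣p∣⇒p≡q : {p q : Subset V} → p ⊆ q → ∣ q ∣ ≤ ∣ p ∣ → p ≡ q
  p⊆q∧∣q∣≤∣p∣⇒p≡q {p} {q} p⊆q ∣q∣≤∣p∣ with q ⊆? p
  ... | yes q⊆p = ⊆-antisym p⊆q q⊆p
  ... | no q⊈p = contradiction ∣q∣≤∣p∣ (<⇒≱ (p⊂q⇒∣p∣<∣q∣ (p⊆q , ⊈⇒∃∉ q⊈p)))

  ∣p∣≡1+k⇒Nonempty : ∀ {k} {p : Subset V} → ∣ p ∣ ≡ suc k → Nonempty p
  ∣p∣≡1+k⇒Nonempty {p = p} ∣p∣≡1+k with nonempty? p
  ... | yes nonempty = nonempty
  ... | no empty = contradiction
    (trans (sym ∣p∣≡1+k) (trans (cong ∣_∣ (Empty-unique empty)) (∣⊥∣≡0 V))) λ ()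

  ∪-least : {p q r : Subset V} → p ⊆ r → q ⊆ r → p ∪ q ⊆ r
  ∪-least {p} {q} p⊆r q⊆r x∈p∪q = [ p⊆r , q⊆r ] (x∈p∪q⁻ p q x∈p∪q)

  distinct-⊆-∪≡ : ∀ {k} {A B X : Subset V} → ∣ A ∣ ≡ k → ∣ B ∣ ≡ k → ∣ X ∣ ≡ suc k →
                  A ≢ B → A ⊆ X → B ⊆ X → A ∪ B ≡ X
  distinct-⊆-∪≡ {k} {A} {B} ∣A∣≡k ∣B∣≡k ∣X∣≡1+k A≢B A⊆X B⊆X with ∣ A ∪ B ∣ ≤? k
  ... | yes small = contradiction
    (trans (p⊆q∧∣q∣≤∣p∣⇒p≡q (p⊆p∪q B) (subst (∣ A ∪ B ∣ ≤_) (sym ∣A∣≡k) small))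
           (sym (p⊆q∧∣q∣≤∣p∣⇒p≡q (q⊆p∪q A B) (subst (∣ A ∪ B ∣ ≤_) (sym ∣B∣≡k) small))))
    A≢B
  ... | no large = p⊆q∧∣q∣≤∣p∣⇒p≡q (∪-least A⊆X B⊆X)
    (subst (_≤ ∣ A ∪ B ∣) (sym ∣X∣≡1+k) (≰⇒> large))

⊆-of-size : ∀ {V} (p : Subset V) {k} → k ≤ ∣ p ∣ → ∃[ τ ] τ ⊆ p × ∣ τ ∣ ≡ k
⊆-of-size {V} p {zero} _ = ∅ , ⊥⊆ , ∣⊥∣≡0 V
⊆-of-size (outside ∷ p) {suc k} k<∣p∣ =
  let τ , τ⊆p , ∣τ∣≡ = ⊆-of-size p k<∣p∣ in outside ∷ τ , out⊆ τ⊆p , ∣τ∣≡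
⊆-of-size (inside ∷ p) {suc k} (s≤s k≤∣p∣) =
  let τ , τ⊆p , ∣τ∣≡ = ⊆-of-size p k≤∣p∣ in inside ∷ τ , s⊆s τ⊆p , cong suc ∣τ∣≡

⊆-of-size-∋ : ∀ {V} {p : Subset V} {x k} → x ∈ p → k < ∣ p ∣ →
              ∃[ τ ] τ ⊆ p × x ∈ τ × ∣ τ ∣ ≡ suc k
⊆-of-size-∋ {p = p} {x} {zero} x∈p _ =
  ⁅ x ⁆ , (λ y∈⁅x⁆ → subst (_∈ p) (sym (x∈⁅y⁆⇒x≡y x y∈⁅x⁆)) x∈p) , x∈⁅x⁆ x , ∣⁅x⁆∣≡1 x
⊆-of-size-∋ {p = inside ∷ p} {k = suc k} here (s≤s k<∣p∣) =
  let τ , τ⊆p , ∣τ∣≡ = ⊆-of-size p k<∣p∣ in inside ∷ τ , s⊆s τ⊆p , here , cong suc ∣τ∣≡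
⊆-of-size-∋ {p = outside ∷ p} {k = suc k} (there x∈p) k<∣p∣ =
  let τ , τ⊆p , x∈τ , ∣τ∣≡ = ⊆-of-size-∋ x∈p k<∣p∣ in outside ∷ τ , out⊆ τ⊆p , there x∈τ , ∣τ∣≡
⊆-of-size-∋ {p = inside ∷ p} {k = suc k} (there x∈p) (s≤s k<∣p∣) =
  let τ , τ⊆p , x∈τ , ∣τ∣≡ = ⊆-of-size-∋ x∈p k<∣p∣
  in  inside ∷ τ , s⊆s τ⊆p , there x∈τ , cong suc ∣τ∣≡

last-before : ∀ {p} {P : Pred ℕ p} → Decidable P → ∀ {a c} → a ≤ c → P a → ¬ P c →
              ∃[ i ] a ≤ i × i < c × P i × (∀ {k} → i < k → k ≤ c → ¬ P k)
last-before P? {c = zero} z≤n Pa ¬Pc = contradiction Pa ¬Pc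
last-before {P = P} P? {c = suc c} a≤1+c Pa ¬P1+c with m≤n⇒m<n∨m≡n a≤1+c
... | inj₂ refl = contradiction Pa ¬P1+c
... | inj₁ (s≤s a≤c) with P? c
...   | yes Pc = c , a≤c , ≤-refl , Pc , λ c<k k≤1+c →
  subst (λ j → ¬ P j) (sym (≤-antisym k≤1+c c<k)) ¬P1+c
...   | no ¬Pc =
  let i , a≤i , i<c , Pi , gap = last-before P? a≤c Pa ¬Pc
  in  i , a≤i , m<n⇒m<1+n i<c , Pi , λ i<k k≤1+c →
        [ (λ k<1+c → gap i<k (≤-pred k<1+c)) , (λ { refl → ¬P1+c }) ] (m≤n⇒m<n∨m≡n k≤1+c)

≤∸1⇒< : ∀ {k ℓ} → k ≤ ℓ ∸ 1 → 0 < ℓ → k < ℓ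
≤∸1⇒< k≤ℓ∸1 (s≤s _) = s≤s k≤ℓ∸1

face-simplex : ∀ {V} (K : SimplicialComplex V) {i j σ τ} →
               IsSimplex K j σ → τ ⊆ σ → ∣ τ ∣ ≡ suc i → IsSimplex K i τ
face-simplex K {σ = σ} {τ} (σ∈K , _) τ⊆σ ∣τ∣≡ =
  down-closed K σ τ σ∈K (∣p∣≡1+k⇒Nonempty ∣τ∣≡) τ⊆σ , ∣τ∣≡

module _ {V : ℕ} (K : SimplicialComplex V) (n : ℕ) where

  -- The part of an (m, n+1)-cycle sequence that does not involve the m-simplices.
  record RidgePath (ℓ : ℕ) : Set where
    field
      facet ridge     : ℕ → Subset V
      facet-simplex   : ∀ k → 1 ≤ k → k ≤ ℓ → IsSimplex K (suc n) (facet k)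
      facet-injective : ∀ p q → 1 ≤ p → p ≤ ℓ → 1 ≤ q → q ≤ ℓ → p ≢ q → facet p ≢ facet q
      ridge-simplex   : ∀ z → 2 ≤ z → z ≤ ℓ → IsSimplex K n (ridge z)
      ridge⊆facet-pred : ∀ z → 2 ≤ z → z ≤ ℓ → ridge z ⊆ facet (z ∸ 1)
      ridge⊆facet     : ∀ z → 2 ≤ z → z ≤ ℓ → ridge z ⊆ facet z
      ridge-injective : ∀ x y → 2 ≤ x → x ≤ ℓ → 2 ≤ y → y ≤ ℓ → x ≢ y → ridge x ≢ ridge y

  cycleSeq⇒ridgePath : ∀ {m r σ η} → IsCycleSeq K m (suc n) r σ η → RidgePath r
  cycleSeq⇒ridgePath {η = η}
    ((_ , steps) , _ , distinct , _ , _ , ridge , ridge-facts , ridge-injective) =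
    record
      { facet            = η
      ; ridge            = ridge
      ; facet-simplex    = λ k 1≤k k≤r → proj₁ (steps k 1≤k k≤r)
      ; facet-injective  = λ p q 1≤p p≤r 1≤q q≤r p≢q → proj₂ (distinct p q 1≤p p≤r 1≤q q≤r p≢q)
      ; ridge-simplex    = λ z 2≤z z≤r → proj₁ (ridge-facts z 2≤z z≤r)
      ; ridge⊆facet-pred = λ z 2≤z z≤r → proj₁ (proj₂ (ridge-facts z 2≤z z≤r))
      ; ridge⊆facet      = λ z 2≤z z≤r → proj₁ (proj₂ (proj₂ (ridge-facts z 2≤z z≤r)))
      ; ridge-injective  = ridge-injective
      }

  -- Shifting on the right makes facet 1 = facet (suc o) and (z ∸ 1) + o = z + o ∸ 1
  -- (for z = suc _) hold by computation.
  window : ∀ {ℓ ℓ′} → RidgePath ℓ → ∀ o → ℓ′ + o ≤ ℓ → RidgePath ℓ′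
  window {ℓ} {ℓ′} P o ℓ′+o≤ℓ = record
    { facet            = λ k → facet (k + o)
    ; ridge            = λ k → ridge (k + o)
    ; facet-simplex    = λ k 1≤k k≤ℓ′ → facet-simplex (k + o) (lower 1≤k) (upper k≤ℓ′)
    ; facet-injective  = λ p q 1≤p p≤ℓ′ 1≤q q≤ℓ′ p≢q → facet-injective (p + o) (q + o)
        (lower 1≤p) (upper p≤ℓ′) (lower 1≤q) (upper q≤ℓ′) (shift-injective p≢q)
    ; ridge-simplex    = λ z 2≤z z≤ℓ′ → ridge-simplex (z + o) (lower 2≤z) (upper z≤ℓ′)
    ; ridge⊆facet-pred = λ { z@(suc _) 2≤z z≤ℓ′ → ridge⊆facet-pred (z + o) (lower 2≤z) (upper z≤ℓ′) }
    ; ridge⊆facet      = λ z 2≤z z≤ℓ′ → ridge⊆facet (z + o) (lower 2≤z) (upper z≤ℓ′)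
    ; ridge-injective  = λ x y 2≤x x≤ℓ′ 2≤y y≤ℓ′ x≢y → ridge-injective (x + o) (y + o)
        (lower 2≤x) (upper x≤ℓ′) (lower 2≤y) (upper y≤ℓ′) (shift-injective x≢y)
    }
    where
    open RidgePath P
    lower : ∀ {j k} → j ≤ k → j ≤ k + o
    lower {k = k} j≤k = ≤-trans j≤k (m≤m+n k o)
    upper : ∀ {k} → k ≤ ℓ′ → k + o ≤ ℓ
    upper k≤ℓ′ = ≤-trans (+-monoˡ-≤ o k≤ℓ′) ℓ′+o≤ℓ
    shift-injective : ∀ {p q} → p ≢ q → p + o ≢ q + o
    shift-injective p≢q = p≢q ∘ +-cancelʳ-≡ o _ _

  record Detour (m ℓ : ℕ) : Set where
    field
      path       : RidgePath ℓ
      face       : Subset V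
      face-size  : ∣ face ∣ ≡ suc m
      long       : 3 ≤ ℓ
      ⊆-first    : face ⊆ RidgePath.facet path 1
      ⊆-last     : face ⊆ RidgePath.facet path ℓ
      ⊈-inner    : ∀ k → 2 ≤ k → k < ℓ → face ⊈ RidgePath.facet path k

  detour-within : ∀ {m ℓ a b} (P : RidgePath ℓ) {ρ} → ∣ ρ ∣ ≡ suc m → 1 ≤ a → a ≤ b → suc b ≤ ℓ →
            let open RidgePath P in
            ρ ⊆ facet a → ρ ⊈ facet b → ρ ⊆ facet (suc b) → ∃[ ℓ′ ] ℓ′ ≤ suc b × Detour m ℓ′
  detour-within {b = b} P {ρ} ∣ρ∣≡ 1≤a a≤b 1+b≤ℓ ρ⊆a ρ⊈b ρ⊆1+b
    with last-before (λ k → ρ ⊆? RidgePath.facet P k) a≤b ρ⊆a ρ⊈b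
  ... | suc o , a≤i , i<b , ρ⊆i , gap = ℓ′ , m∸n≤m (suc b) o , record
    { path      = window P o (≤-trans (≤-reflexive ℓ′+o≡1+b) 1+b≤ℓ)
    ; face      = ρ
    ; face-size = ∣ρ∣≡
    ; long      = +-cancelʳ-≤ o 3 ℓ′ (≤-trans (s≤s i<b) (≤-reflexive (sym ℓ′+o≡1+b)))
    ; ⊆-first   = ρ⊆i
    ; ⊆-last    = subst (λ j → ρ ⊆ RidgePath.facet P j) (sym ℓ′+o≡1+b) ρ⊆1+b
    ; ⊈-inner   = λ k 2≤k k<ℓ′ → gap (+-monoˡ-≤ o 2≤k)
                      (≤-pred (≤-trans (+-monoˡ-< o k<ℓ′) (≤-reflexive ℓ′+o≡1+b)))
    }
    where
    ℓ′ = suc b ∸ o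
    ℓ′+o≡1+b : ℓ′ + o ≡ suc b
    ℓ′+o≡1+b = m∸n+n≡m (≤-trans (n≤1+n o) (≤-trans (<⇒≤ i<b) (n≤1+n b)))
  ... | zero , a≤0 , _ = contradiction (≤-trans 1≤a a≤0) λ ()

  -- Two consecutive ridges of the path are distinct ridges of the same facet, so
  -- if a ridge also lay in the facet before, that facet would repeat.
  ridge⊈facet-two-back : ∀ {ℓ} (P : RidgePath ℓ) → let open RidgePath P in
                         ∀ k → 3 ≤ k → k ≤ ℓ → ridge k ⊈ facet (k ∸ 2)
  ridge⊈facet-two-back P 1 (s≤s ())
  ridge⊈facet-two-back P 2 (s≤s (s≤s ()))
  ridge⊈facet-two-back {ℓ} P k@(suc (suc j@(suc _))) 3≤k k≤ℓ ridge-k⊆facet-j =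
    facet-injective j (suc j) (s≤s z≤n) j≤ℓ (s≤s z≤n) 1+j≤ℓ (<⇒≢ (n<1+n j))
      (trans (sym (spans (s≤s z≤n) j≤ℓ (ridge⊆facet-pred (suc j) 2≤1+j 1+j≤ℓ) ridge-k⊆facet-j))
             (spans (s≤s z≤n) 1+j≤ℓ (ridge⊆facet (suc j) 2≤1+j 1+j≤ℓ) (ridge⊆facet-pred k 2≤k k≤ℓ)))
    where
    open RidgePath P
    1+j≤ℓ : suc j ≤ ℓ
    1+j≤ℓ = ≤-trans (n≤1+n (suc j)) k≤ℓ
    j≤ℓ : j ≤ ℓ
    j≤ℓ = ≤-trans (n≤1+n j) 1+j≤ℓ
    2≤1+j : 2 ≤ suc j
    2≤1+j = ≤-pred 3≤k
    2≤k : 2 ≤ k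
    2≤k = ≤-trans (n≤1+n 2) 3≤k
    spans : ∀ {f} → 1 ≤ f → f ≤ ℓ → ridge (suc j) ⊆ facet f → ridge k ⊆ facet f →
            ridge (suc j) ∪ ridge k ≡ facet f
    spans {f} 1≤f f≤ℓ = distinct-⊆-∪≡
      (proj₂ (ridge-simplex (suc j) 2≤1+j 1+j≤ℓ)) (proj₂ (ridge-simplex k 2≤k k≤ℓ))
      (proj₂ (facet-simplex f 1≤f f≤ℓ))
      (ridge-injective (suc j) k 2≤1+j 1+j≤ℓ 2≤k k≤ℓ (<⇒≢ (n<1+n (suc j))))

  module Splice {m ℓ} (m≤n : m ≤ n) (D : Detour m ℓ) where
    open Detour D
    open RidgePath path

    record Escaping (k : ℕ) (τ : Subset V) : Set where
      field
        ⊆-ridge            : τ ⊆ ridge k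
        size               : ∣ τ ∣ ≡ suc m
        ⊈-facet-two-back : 3 ≤ k → τ ⊈ facet (k ∸ 2)
    open Escaping

    1<ℓ : 1 < ℓ
    1<ℓ = ≤-trans (n≤1+n 2) long

    m<∣ridge∣ : ∀ k → 2 ≤ k → k ≤ ℓ → m < ∣ ridge k ∣
    m<∣ridge∣ k 2≤k k≤ℓ = subst (m <_) (sym (proj₂ (ridge-simplex k 2≤k k≤ℓ))) (s≤s m≤n)

    escaping : ∀ k → 2 ≤ k → k ≤ ℓ → ∃ (Escaping k)
    escaping k 2≤k k≤ℓ with 3 ≤? k
    ... | yes 3≤k =
      let x , x∈ridge , x∉facet = ⊈⇒∃∉ (ridge⊈facet-two-back path k 3≤k k≤ℓ)
          τ , τ⊆ridge , x∈τ , ∣τ∣≡ = ⊆-of-size-∋ x∈ridge (m<∣ridge∣ k 2≤k k≤ℓ)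
      in  τ , record { ⊆-ridge = τ⊆ridge ; size = ∣τ∣≡
                     ; ⊈-facet-two-back = λ _ τ⊆facet → x∉facet (τ⊆facet x∈τ) }
    ... | no 3≰k =
      let τ , τ⊆ridge , ∣τ∣≡ = ⊆-of-size (ridge k) (m<∣ridge∣ k 2≤k k≤ℓ)
      in  τ , record { ⊆-ridge = τ⊆ridge ; size = ∣τ∣≡
                     ; ⊈-facet-two-back = λ 3≤k → contradiction 3≤k 3≰k }

    σ : ℕ → Subset V
    σ k with 2 ≤? k | k ≤? ℓ
    ... | yes 2≤k | yes k≤ℓ = proj₁ (escaping k 2≤k k≤ℓ)
    ... | _       | _       = face

    σ-escaping : ∀ k → 2 ≤ k → k ≤ ℓ → Escaping k (σ k)
    σ-escaping k 2≤k k≤ℓ with 2 ≤? k | k ≤? ℓ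
    ... | yes 2≤k′ | yes k≤ℓ′ = proj₂ (escaping k 2≤k′ k≤ℓ′)
    ... | no 2≰k   | _        = contradiction 2≤k 2≰k
    ... | yes _    | no k≰ℓ   = contradiction k≤ℓ k≰ℓ

    σ-last : σ (suc ℓ) ≡ face
    σ-last with 2 ≤? suc ℓ | suc ℓ ≤? ℓ
    ... | _     | yes ℓ<ℓ = contradiction ℓ<ℓ (n≮n ℓ)
    ... | yes _ | no _    = refl
    ... | no _  | no _    = refl

    σ⊆facet : ∀ k → 1 ≤ k → k ≤ ℓ → σ k ⊆ facet k
    σ⊆facet 1 _ _ = ⊆-first
    σ⊆facet k@(suc (suc _)) _ k≤ℓ =
      ⊆-trans (⊆-ridge (σ-escaping k (s≤s (s≤s z≤n)) k≤ℓ)) (ridge⊆facet k (s≤s (s≤s z≤n)) k≤ℓ)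

    σ-suc⊆facet : ∀ k → 1 ≤ k → k ≤ ℓ → σ (suc k) ⊆ facet k
    σ-suc⊆facet k 1≤k k≤ℓ with m≤n⇒m<n∨m≡n k≤ℓ
    ... | inj₁ k<ℓ  = ⊆-trans (⊆-ridge (σ-escaping (suc k) (s≤s 1≤k) k<ℓ))
                              (ridge⊆facet-pred (suc k) (s≤s 1≤k) k<ℓ)
    ... | inj₂ refl = subst (_⊆ facet ℓ) (sym σ-last) ⊆-last

    σ-size : ∀ k → 1 ≤ k → k ≤ suc ℓ → ∣ σ k ∣ ≡ suc m
    σ-size 1 _ _ = face-size
    σ-size k@(suc (suc _)) _ k≤1+ℓ with m≤n⇒m<n∨m≡n k≤1+ℓ
    ... | inj₁ k<1+ℓ  = size (σ-escaping k (s≤s (s≤s z≤n)) (≤-pred k<1+ℓ))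
    ... | inj₂ k≡1+ℓ = trans (cong (∣_∣ ∘ σ) k≡1+ℓ) (trans (cong ∣_∣ σ-last) face-size)

    σ-simplex : ∀ k → 1 ≤ k → k ≤ suc ℓ → IsSimplex K m (σ k)
    σ-simplex 1 _ _ = face-simplex K (facet-simplex 1 ≤-refl (<⇒≤ 1<ℓ)) ⊆-first face-size
    σ-simplex k@(suc j@(suc _)) 1≤k (s≤s j≤ℓ) =
      face-simplex K (facet-simplex j (s≤s z≤n) j≤ℓ) (σ-suc⊆facet j (s≤s z≤n) j≤ℓ)
                   (σ-size k 1≤k (s≤s j≤ℓ))

    face≢σ : ∀ q → 2 ≤ q → q ≤ ℓ → face ≢ σ q
    face≢σ q@(suc j) 2≤q q≤ℓ face≡σq with m≤n⇒m<n∨m≡n q≤ℓ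
    ... | inj₁ q<ℓ   = ⊈-inner q 2≤q q<ℓ
                         (subst (_⊆ facet q) (sym face≡σq) (σ⊆facet q (s≤s z≤n) q≤ℓ))
    ... | inj₂ q≡ℓ = ⊈-inner j 2≤j (≤-reflexive q≡ℓ)
                         (subst (_⊆ facet j) (sym face≡σq) (σ-suc⊆facet j 1≤j (<⇒≤ (≤-reflexive q≡ℓ))))
      where
      2≤j : 2 ≤ j
      2≤j = ≤-pred (≤-trans long (≤-reflexive (sym q≡ℓ)))
      1≤j : 1 ≤ j
      1≤j = ≤-trans (n≤1+n 1) 2≤j

    Collision : Set
    Collision = ∃[ w ] w < suc ℓ × ∃[ z ] z < w × 2 ≤ z × σ z ≡ σ w

    collision? : Dec Collision
    collision? = anyUpTo? (λ w → anyUpTo? (λ z → 2 ≤? z ×-dec ≡-dec _≟ᴮ_ (σ z) (σ w)) w) (suc ℓ)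

    module _ (no-collision : ¬ Collision) where

      σ-injective : ∀ p q → 1 ≤ p → p ≤ ℓ → 1 ≤ q → q ≤ ℓ → p ≢ q → σ p ≢ σ q
      σ-injective 1 1 _ _ _ _ 1≢1 = contradiction refl 1≢1
      σ-injective 1 q@(suc (suc _)) _ _ _ q≤ℓ _ = face≢σ q (s≤s (s≤s z≤n)) q≤ℓ
      σ-injective p@(suc (suc _)) 1 _ p≤ℓ _ _ _ = face≢σ p (s≤s (s≤s z≤n)) p≤ℓ ∘ sym
      σ-injective p@(suc (suc _)) q@(suc (suc _)) _ p≤ℓ _ q≤ℓ p≢q with <-cmp p q
      ... | tri< p<q _ _ = λ σp≡σq → no-collision (q , s≤s q≤ℓ , p , p<q , s≤s (s≤s z≤n) , σp≡σq)
      ... | tri≈ _ p≡q _ = contradiction p≡q p≢q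
      ... | tri> _ _ q<p = λ σp≡σq → no-collision (p , s≤s p≤ℓ , q , q<p , s≤s (s≤s z≤n) , sym σp≡σq)

      σ-step-injective : ∀ k → 1 ≤ k → k ≤ ℓ → σ k ≢ σ (suc k)
      σ-step-injective k 1≤k k≤ℓ with m≤n⇒m<n∨m≡n k≤ℓ
      ... | inj₁ k<ℓ  = σ-injective k (suc k) 1≤k k≤ℓ (s≤s z≤n) k<ℓ (<⇒≢ (n<1+n k))
      ... | inj₂ refl = subst (σ ℓ ≢_) (sym σ-last) (σ-injective ℓ 1 1≤k ≤-refl ≤-refl 1≤k (>⇒≢ 1<ℓ))

      cycleSeq : IsCycleSeq K m (suc n) ℓ σ facet
      cycleSeq =
        ( σ-simplex
        , λ k 1≤k k≤ℓ → facet-simplex k 1≤k k≤ℓ , σ-step-injective k 1≤k k≤ℓ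
                       , σ⊆facet k 1≤k k≤ℓ , σ-suc⊆facet k 1≤k k≤ℓ )
        , σ-last
        , (λ p q 1≤p p≤ℓ 1≤q q≤ℓ p≢q → σ-injective p q 1≤p p≤ℓ 1≤q q≤ℓ p≢q
                                     , facet-injective p q 1≤p p≤ℓ 1≤q q≤ℓ p≢q)
        , long
        , (λ k 2≤k k≤ℓ∸1 → ⊈-inner k 2≤k (≤∸1⇒< k≤ℓ∸1 (<⇒≤ 1<ℓ)))
        , ridge
        , (λ z 2≤z z≤ℓ → ridge-simplex z 2≤z z≤ℓ , ridge⊆facet-pred z 2≤z z≤ℓ
                       , ridge⊆facet z 2≤z z≤ℓ , ⊆-ridge (σ-escaping z 2≤z z≤ℓ))
        , ridge-injective

    -- σ_z = σ_w lies in facet z-1 and facet w-1 but not in facet w-2, so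
    -- tightening between z-1 and w-2 gives a strictly shorter detour.
    shorten : Collision → ∃[ ℓ′ ] ℓ′ < ℓ × Detour m ℓ′
    shorten (w@(suc (suc w′)) , s≤s w≤ℓ , z@(suc z′) , s≤s (s≤s z′≤w′) , s≤s 1≤z′ , σz≡σw) =
      let ℓ′ , ℓ′≤1+w′ , D′ = detour-within path (size escapes) 1≤z′ z′≤w′ 1+w′≤ℓ
                                σw⊆facet-z′ (⊈-facet-two-back escapes 3≤w) σw⊆facet-1+w′
      in  ℓ′ , ≤-trans (s≤s ℓ′≤1+w′) w≤ℓ , D′
      where
      2≤z : 2 ≤ z
      2≤z = s≤s 1≤z′
      3≤w : 3 ≤ w
      3≤w = s≤s (s≤s (≤-trans 1≤z′ z′≤w′))
      1+w′≤ℓ : suc w′ ≤ ℓ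
      1+w′≤ℓ = ≤-trans (n≤1+n (suc w′)) w≤ℓ
      escapes : Escaping w (σ w)
      escapes = σ-escaping w (≤-trans (n≤1+n 2) 3≤w) w≤ℓ
      σw⊆facet-z′ : σ w ⊆ facet z′
      σw⊆facet-z′ = subst (_⊆ facet z′) σz≡σw
        (⊆-trans (⊆-ridge (σ-escaping z 2≤z z≤ℓ)) (ridge⊆facet-pred z 2≤z z≤ℓ))
        where
        z≤ℓ : z ≤ ℓ
        z≤ℓ = ≤-trans (s≤s (≤-trans z′≤w′ (n≤1+n w′))) w≤ℓ
      σw⊆facet-1+w′ : σ w ⊆ facet (suc w′)
      σw⊆facet-1+w′ = ⊆-trans (⊆-ridge escapes) (ridge⊆facet-pred w (≤-trans (n≤1+n 2) 3≤w) w≤ℓ)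

    cycleSeq⊎shorter : HasCycleSeq K m (suc n) ⊎ ∃[ ℓ′ ] ℓ′ < ℓ × Detour m ℓ′
    cycleSeq⊎shorter with collision?
    ... | no no-collision = inj₁ (ℓ , σ , facet , cycleSeq no-collision)
    ... | yes collision   = inj₂ (shorten collision)

  detour⇒cycleSeq : ∀ {m ℓ} → m ≤ n → Detour m ℓ → HasCycleSeq K m (suc n)
  detour⇒cycleSeq {m} {ℓ} m≤n = <-rec (λ ℓ → Detour m ℓ → HasCycleSeq K m (suc n)) step ℓ
    where
    step : ∀ ℓ → (∀ {ℓ′} → ℓ′ < ℓ → Detour m ℓ′ → HasCycleSeq K m (suc n)) →
           Detour m ℓ → HasCycleSeq K m (suc n)
    step _ shorter⇒cycleSeq D =
      [ id , (λ (_ , ℓ′<ℓ , D′) → shorter⇒cycleSeq ℓ′<ℓ D′) ] (Splice.cycleSeq⊎shorter m≤n D)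

  ridgeCycleSeq⇒detour : ∀ {m} → m ≤ n → HasCycleSeq K n (suc n) → ∃ (Detour m)
  ridgeCycleSeq⇒detour m≤n (zero , _ , _ , _ , _ , _ , () , _)
  ridgeCycleSeq⇒detour {m} m≤n
    (suc r′ , σ , η , cycle@((σ-simplex , steps) , closed , _ , 3≤r , σ₁⊈inner , _)) =
    let x , x∈σ₁ , x∉η-r′ = ⊈⇒∃∉ (σ₁⊈inner r′ (≤-pred 3≤r) ≤-refl)
        ρ , ρ⊆σ₁ , x∈ρ , ∣ρ∣≡ = ⊆-of-size-∋ x∈σ₁ m<∣σ₁∣
        ℓ , _ , D = detour-within (cycleSeq⇒ridgePath cycle) ∣ρ∣≡ ≤-refl 1≤r′ ≤-refl
                      (⊆-trans ρ⊆σ₁ σ₁⊆η₁) (λ ρ⊆η-r′ → x∉η-r′ (ρ⊆η-r′ x∈ρ)) (⊆-trans ρ⊆σ₁ σ₁⊆η-r)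
    in  ℓ , D
    where
    1≤r′ : 1 ≤ r′
    1≤r′ = ≤-pred (≤-trans (n≤1+n 2) 3≤r)
    m<∣σ₁∣ : m < ∣ σ 1 ∣
    m<∣σ₁∣ = subst (m <_) (sym (proj₂ (σ-simplex 1 ≤-refl (s≤s z≤n)))) (s≤s m≤n)
    σ₁⊆η₁ : σ 1 ⊆ η 1
    σ₁⊆η₁ = proj₁ (proj₂ (proj₂ (steps 1 ≤-refl (s≤s z≤n))))
    σ₁⊆η-r : σ 1 ⊆ η (suc r′)
    σ₁⊆η-r = subst (_⊆ η (suc r′)) closed (proj₂ (proj₂ (proj₂ (steps (suc r′) (s≤s z≤n) ≤-refl))))

  ridgeCycleSeq⇒cycleSeq : ∀ {m} → m ≤ n → HasCycleSeq K n (suc n) → HasCycleSeq K m (suc n)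
  ridgeCycleSeq⇒cycleSeq m≤n cycle = detour⇒cycleSeq m≤n (proj₂ (ridgeCycleSeq⇒detour m≤n cycle))

corollary4p3 : (V n : ℕ) (K : SimplicialComplex V) → 2 ≤ n → IsPure K n →
    HasCycleSeq K (n ∸ 1) n →
    ∀ m → m ≤ n ∸ 2 → HasCycleSeq K m n
corollary4p3 V (suc n) K (s≤s _) _ cycle m m≤n∸1 =
  ridgeCycleSeq⇒cycleSeq K n (≤-trans m≤n∸1 (m∸n≤m n 1)) cycle
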